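{- For all integers $k,\ell\ge 3$, $\chi_o^+(P_k\boxtimes P_\ell)\le 126$.
   Context: $P_k$ is the undirected path on $k$ vertices. An oriented graph is a digraph with no loops, no multiple arcs and no pair of opposite arcs; an orientation of an undirected graph gives each edge one of its two directions. A homomorphism between oriented graphs is a vertex map sending arcs to arcs. The upper oriented chromatic number $\chi_o^+(G)$ is the smallest order of an oriented graph $\vec T$ such that every orientation of $G$ admits a homomorphism to $\vec T$. The strong product $G\boxtimes H$ has vertex set $V(G)\times V(H)$, and $\{[u,v],[u',v']\}$ is an edge iff either $u=u'$ and $\{v,v'\}\in E(H)$, or $v=v'$ and $\{u,u'\}\in E(G)$, or $\{u,u'\}\in E(G)$ and $\{v,v'\}\in E(H)$. -}

module Defs where

open import Data.Nat using (ℕ; suc; _≤_)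
open import Data.Fin using (Fin; toℕ)
open import Data.Bool using (Bool; true)
open import Data.Product using (_×_; _,_; Σ; ∃)
open import Data.Sum using (_⊎_)
open import Data.Empty using (⊥)
open import Relation.Binary.PropositionalEquality using (_≡_)

record Graph (V : Set) : Set₁ where
  field
    Adj : V → V → Set

PathAdj : (k : ℕ) → Fin k → Fin k → Set
PathAdj k i j = toℕ j ≡ suc (toℕ i) ⊎ toℕ i ≡ suc (toℕ j)

P : (k : ℕ) → Graph (Fin k)
P k = record { Adj = PathAdj k }

_⊠_ : {V W : Set} → Graph V → Graph W → Graph (V × W)
_⊠_ {V} {W} G H = record { Adj = adj }
  where
  adj : V × W → V × W → Set
  adj (u , v) (u' , v') =
      (u ≡ u' × Graph.Adj H v v')
    ⊎ (v ≡ v' × Graph.Adj G u u')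
    ⊎ (Graph.Adj G u u' × Graph.Adj H v v')

-- An oriented graph on vertex type V: an arc relation with no loops and
-- no pair of opposite arcs (multiple arcs are impossible for a relation).
record OrientedGraph (V : Set) : Set where
  field
    arc      : V → V → Bool
    noLoop   : ∀ u → arc u u ≡ true → ⊥
    noOpp    : ∀ u v → arc u v ≡ true → arc v u ≡ true → ⊥

record Orientation {V : Set} (G : Graph V) : Set where
  field
    oriented : OrientedGraph V
  open OrientedGraph oriented public
  field
    arc⇒edge : ∀ u v → arc u v ≡ true → Graph.Adj G u v
    edge⇒arc : ∀ u v → Graph.Adj G u v → arc u v ≡ true ⊎ arc v u ≡ true

Hom : {V W : Set} → OrientedGraph V → OrientedGraph W → Set
Hom {V} {W} D T =
  Σ (V → W) λ f → ∀ u v → OrientedGraph.arc D u v ≡ true →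
                          OrientedGraph.arc T (f u) (f v) ≡ true

UpperOrientedChromatic≤ : {V : Set} → Graph V → ℕ → Set
UpperOrientedChromatic≤ {V} G n =
  Σ ℕ λ m → m ≤ n × Σ (OrientedGraph (Fin m)) λ T →
    (O : Orientation G) → Hom (Orientation.oriented O) T

-- Colour the grid vertex (i , j) by i + 2j in ℤ/7; neighbours then differ by ±1, ±2 or ±3,
-- and for each g ∈ {1,2,3} the edges from colour c to colour c + g form paths: rows for
-- g = 2, diagonals for g = 3, and for g = 1 zigzags of vertical and antidiagonal edges once
-- each vertex is split into a tail and a head copy.  On a path an orientation is recorded
-- by an xor-potential, a bit per vertex whose change across an edge says whether the edge
-- points from c to c + g.  So every orientation maps into the oriented graph on ℤ/7 × 𝔹⁴
-- that joins c to c + g in the direction given by the xor of the relevant bits, and this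
-- graph has 112 ≤ 126 vertices.
module Submission where

open import Defs
open import Data.Bool using (Bool; true; false; not; _∧_; _∨_; _xor_)
open import Data.Bool.Properties using (not-involutive; not-¬; ¬-not; ∨-identityʳ)
  renaming (_≟_ to _≟ᵇ_)
open import Data.Empty using (⊥; ⊥-elim)
open import Data.Fin using (Fin; zero; toℕ; fromℕ<)
open import Data.Fin.Properties using (fromℕ<-toℕ; toℕ<n; all?; 2↔Bool; *↔×)
open import Data.Maybe using (Maybe; just; zip)
import Data.Maybe as Maybe
open import Data.Nat using (ℕ; zero; suc; _+_; _*_; _≤_; _<?_)
open import Data.Nat.DivMod using (_mod_; _%_)
open import Data.Nat.Properties using (m≤m+n) renaming (_≟_ to _≟ⁿ_)
open import Data.Product using (_×_; _,_; ∃)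
import Data.Product as Product
open import Data.Product.Function.NonDependent.Propositional using (_×-↔_)
open import Data.Sum using (_⊎_; inj₁; inj₂)
open import Function using (_↔_; Inverse; _∘_; id)
open import Function.Properties.Inverse using (↔-refl; ↔-trans)
open import Relation.Nullary.Decidable using (yes; no; from-yes; dec⇒maybe; _→-dec_)
open import Relation.Binary.PropositionalEquality
  using (_≡_; refl; sym; trans; cong; subst₂)

pullback : {X Y : Set} → (Y → X) → OrientedGraph X → OrientedGraph Y
pullback g T = record
  { arc    = λ y y' → arc (g y) (g y')
  ; noLoop = λ y → noLoop (g y)
  ; noOpp  = λ y y' → noOpp (g y) (g y')
  }
  where open OrientedGraph T

Hom-pullback : {V X Y : Set} {D : OrientedGraph V} {T : OrientedGraph X}
  (g : Y → X) (s : X → Y) → (∀ x → g (s x) ≡ x) → Hom D T → Hom D (pullback g T)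
Hom-pullback {T = T} g s g∘s≡id (f , f-hom) =
  s ∘ f , λ u v uv → subst₂ (λ x y → OrientedGraph.arc T x y ≡ true)
                            (sym (g∘s≡id (f u))) (sym (g∘s≡id (f v))) (f-hom u v uv)

upperOrientedChromatic≤-via : {V X : Set} {G : Graph V} {m n : ℕ} →
  m ≤ n → Fin m ↔ X → (T : OrientedGraph X) →
  ((O : Orientation G) → Hom (Orientation.oriented O) T) →
  UpperOrientedChromatic≤ G n
upperOrientedChromatic≤-via {m = m} m≤n Fin↔X T hom =
  m , m≤n , pullback to T , λ O →
    Hom-pullback {D = Orientation.oriented O} {T = T} to from strictlyInverseˡ (hom O)
  where open Inverse Fin↔X

-- `along x y` is consulted only when x, y is a forward pair; it says whether the arc
-- between them points forwards.
module Orient {X : Set} (forward along : X → X → Bool)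
  (forward-irrefl : ∀ x → forward x x ≡ false)
  (forward-asym : ∀ x y → forward x y ≡ true → forward y x ≡ false) where

  arc : X → X → Bool
  arc x y = (forward x y ∧ along x y) ∨ (forward y x ∧ not (along y x))

  arc-forward : ∀ {x y} → forward x y ≡ true → arc x y ≡ along x y
  arc-forward {x} {y} fxy rewrite fxy | forward-asym x y fxy = ∨-identityʳ (along x y)

  arc-backward : ∀ {x y} → forward y x ≡ true → arc x y ≡ not (along y x)
  arc-backward {x} {y} fyx rewrite fyx | forward-asym y x fyx = refl

  arc⇒forward : ∀ x y → arc x y ≡ true → forward x y ≡ true ⊎ forward y x ≡ true
  arc⇒forward x y _  with forward x y | forward y x
  arc⇒forward x y _  | true  | _     = inj₁ refl
  arc⇒forward x y _  | false | true  = inj₂ refl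
  arc⇒forward x y () | false | false

  oriented : OrientedGraph X
  oriented = record
    { arc    = arc
    ; noLoop = noLoop
    ; noOpp  = noOpp
    }
    where
    noLoop : ∀ x → arc x x ≡ true → ⊥
    noLoop x xx with forward x x | forward-irrefl x
    noLoop x () | false | refl

    noOpp : ∀ x y → arc x y ≡ true → arc y x ≡ true → ⊥
    noOpp x y xy yx with arc⇒forward x y xy
    ... | inj₁ fxy = not-¬ (trans (sym xy) (arc-forward fxy)) (trans (sym yx) (arc-backward fxy))
    ... | inj₂ fyx = not-¬ (trans (sym yx) (arc-forward fyx)) (trans (sym xy) (arc-backward fyx))

Col : Set
Col = Fin 7

rot : Col → Col
rot c = suc (toℕ c) mod 7

-- c' − c in ℤ/7
gap : Col → Col → ℕ
gap c c' = (toℕ c' + 6 * toℕ c) % 7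

gap-self : ∀ c → gap c c ≡ 0
gap-self = from-yes (all? λ c → gap c c ≟ⁿ 0)

gap-rot : ∀ c → gap c (rot c) ≡ 1
gap-rot = from-yes (all? λ c → gap c (rot c) ≟ⁿ 1)

gap-rot² : ∀ c → gap c (rot (rot c)) ≡ 2
gap-rot² = from-yes (all? λ c → gap c (rot (rot c)) ≟ⁿ 2)

gap-rot³ : ∀ c → gap c (rot (rot (rot c))) ≡ 3
gap-rot³ = from-yes (all? λ c → gap c (rot (rot (rot c))) ≟ⁿ 3)

isForward : ℕ → Bool
isForward 1 = true
isForward 2 = true
isForward 3 = true
isForward _ = false

isForward-gap-asym : ∀ c c' → isForward (gap c c') ≡ true → isForward (gap c' c) ≡ false
isForward-gap-asym = from-yes (all? λ c → all? λ c' →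
  (isForward (gap c c') ≟ᵇ true) →-dec (isForward (gap c' c) ≟ᵇ false))

Bits : Set
Bits = Bool × Bool × Bool × Bool

along : ℕ → Bits → Bits → Bool
along 1 (tail , _)         (_ , head , _)      = tail xor head
along 2 (_ , _ , row , _)  (_ , _ , row' , _)  = row xor row'
along 3 (_ , _ , _ , diag) (_ , _ , _ , diag') = diag xor diag'
along _ _ _ = false

module Target = Orient {Col × Bits}
  (λ (c , _) (c' , _) → isForward (gap c c'))
  (λ (c , b) (c' , b') → along (gap c c') b b')
  (λ (c , _) → cong isForward (gap-self c))
  (λ (c , _) (c' , _) → isForward-gap-asym c c')

Fin16↔Bits : Fin 16 ↔ Bits
Fin16↔Bits =
  ↔-trans (*↔× {2} {8}) (2↔Bool ×-↔
  ↔-trans (*↔× {2} {4}) (2↔Bool ×-↔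
  ↔-trans (*↔× {2} {2}) (2↔Bool ×-↔ 2↔Bool)))

Fin112↔Col×Bits : Fin 112 ↔ (Col × Bits)
Fin112↔Col×Bits = ↔-trans (*↔× {7} {16}) (↔-refl ×-↔ Fin16↔Bits)

P∞ : Graph ℕ
P∞ = record { Adj = λ i j → j ≡ suc i ⊎ i ≡ suc j }

⊠-map : {V V' W W' : Set} {G : Graph V} {G' : Graph V'} {H : Graph W} {H' : Graph W'}
  (f : V → V') (g : W → W') →
  (∀ {u u'} → Graph.Adj G u u' → Graph.Adj G' (f u) (f u')) →
  (∀ {v v'} → Graph.Adj H v v' → Graph.Adj H' (g v) (g v')) →
  ∀ {x y} → Graph.Adj (G ⊠ H) x y →
  Graph.Adj (G' ⊠ H') (Product.map f g x) (Product.map f g y)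
⊠-map f g f-hom g-hom (inj₁ (refl , vv'))        = inj₁ (refl , g-hom vv')
⊠-map f g f-hom g-hom (inj₂ (inj₁ (refl , uu'))) = inj₂ (inj₁ (refl , f-hom uu'))
⊠-map f g f-hom g-hom (inj₂ (inj₂ (uu' , vv')))  = inj₂ (inj₂ (f-hom uu' , g-hom vv'))

data Step : ℕ → ℕ × ℕ → ℕ × ℕ → Set where
  right : ∀ {i j} → Step 2 (i , j) (i , suc j)
  down  : ∀ {i j} → Step 1 (i , j) (suc i , j)
  diag  : ∀ {i j} → Step 3 (i , j) (suc i , suc j)
  anti  : ∀ {i j} → Step 1 (suc i , j) (i , suc j)

Step⇒isForward : ∀ {g u v} → Step g u v → isForward g ≡ true
Step⇒isForward right = refl
Step⇒isForward down  = refl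
Step⇒isForward diag  = refl
Step⇒isForward anti  = refl

adj⇒Step : ∀ {u v} → Graph.Adj (P∞ ⊠ P∞) u v → ∃ λ g → Step g u v ⊎ Step g v u
adj⇒Step (inj₁ (refl , inj₁ refl))             = 2 , inj₁ right
adj⇒Step (inj₁ (refl , inj₂ refl))             = 2 , inj₂ right
adj⇒Step (inj₂ (inj₁ (refl , inj₁ refl)))      = 1 , inj₁ down
adj⇒Step (inj₂ (inj₁ (refl , inj₂ refl)))      = 1 , inj₂ down
adj⇒Step (inj₂ (inj₂ (inj₁ refl , inj₁ refl))) = 3 , inj₁ diag
adj⇒Step (inj₂ (inj₂ (inj₁ refl , inj₂ refl))) = 1 , inj₂ anti
adj⇒Step (inj₂ (inj₂ (inj₂ refl , inj₁ refl))) = 1 , inj₁ anti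
adj⇒Step (inj₂ (inj₂ (inj₂ refl , inj₂ refl))) = 3 , inj₂ diag

colour : ℕ × ℕ → Col
colour (zero  , zero)  = zero
colour (zero  , suc j) = rot (rot (colour (zero , j)))
colour (suc i , j)     = rot (colour (i , j))

colour-right : ∀ i j → colour (i , suc j) ≡ rot (rot (colour (i , j)))
colour-right zero    j = refl
colour-right (suc i) j = cong rot (colour-right i j)

gap-Step : ∀ {g u v} → Step g u v → gap (colour u) (colour v) ≡ g
gap-Step (right {i} {j}) rewrite colour-right i j = gap-rot² (colour (i , j))
gap-Step (down  {i} {j})                          = gap-rot (colour (i , j))
gap-Step (diag  {i} {j}) rewrite colour-right i j = gap-rot³ (colour (i , j))
gap-Step (anti  {i} {j}) rewrite colour-right i j = gap-rot (rot (colour (i , j)))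

xor-cancelˡ : ∀ x y → x xor (x xor y) ≡ y
xor-cancelˡ true  y = not-involutive y
xor-cancelˡ false y = refl

xor-cancelʳ : ∀ x y → (x xor y) xor y ≡ x
xor-cancelʳ true  true  = refl
xor-cancelʳ true  false = refl
xor-cancelʳ false true  = refl
xor-cancelʳ false false = refl

module Potentials (o : ℕ × ℕ → ℕ × ℕ → Bool) where

  rowBit diagBit tailBit headBit : ℕ × ℕ → Bool
  rowBit (i , zero)  = false
  rowBit (i , suc j) = rowBit (i , j) xor o (i , j) (i , suc j)

  diagBit (zero  , j)     = false
  diagBit (suc i , zero)  = false
  diagBit (suc i , suc j) = diagBit (i , j) xor o (i , j) (suc i , suc j)

  tailBit (zero  , j) = false
  tailBit (suc i , j) = o (suc i , j) (i , suc j) xor headBit (i , suc j)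
  headBit (zero  , j) = false
  headBit (suc i , j) = tailBit (i , j) xor o (i , j) (suc i , j)

  bits : ℕ × ℕ → Bits
  bits u = tailBit u , headBit u , rowBit u , diagBit u

  label : ℕ × ℕ → Col × Bits
  label u = colour u , bits u

  along-Step : ∀ {g u v} → Step g u v → along g (bits u) (bits v) ≡ o u v
  along-Step (right {i} {j}) = xor-cancelˡ (rowBit (i , j)) _
  along-Step (down  {i} {j}) = xor-cancelˡ (tailBit (i , j)) _
  along-Step (diag  {i} {j}) = xor-cancelˡ (diagBit (i , j)) _
  along-Step (anti  {i} {j}) = xor-cancelʳ _ (headBit (i , suc j))

  label-along : ∀ {g u v} → Step g u v →
    along (gap (colour u) (colour v)) (bits u) (bits v) ≡ o u v
  label-along s rewrite gap-Step s = along-Step s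

  label-forward : ∀ {g u v} → Step g u v → isForward (gap (colour u) (colour v)) ≡ true
  label-forward s rewrite gap-Step s = Step⇒isForward s

  label-arc : ∀ {u v} → Graph.Adj (P∞ ⊠ P∞) u v → o u v ≡ true → o v u ≡ false →
    Target.arc (label u) (label v) ≡ true
  label-arc {u} {v} uv o-uv o-vu with adj⇒Step uv
  ... | _ , inj₁ s = trans (Target.arc-forward {label u} {label v} (label-forward s))
                           (trans (label-along s) o-uv)
  ... | _ , inj₂ s = trans (Target.arc-backward {label u} {label v} (label-forward s))
                           (cong not (trans (label-along s) o-vu))

fin? : (n : ℕ) → ℕ → Maybe (Fin n)
fin? n i = Maybe.map (λ i<n → fromℕ< i<n) (dec⇒maybe (i <? n))

fin?-toℕ : ∀ {n} (x : Fin n) → fin? n (toℕ x) ≡ just x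
fin?-toℕ {n} x with toℕ x <? n
... | yes x<n = cong just (fromℕ<-toℕ x x<n)
... | no  x≮n = ⊥-elim (x≮n (toℕ<n x))

module _ {k ℓ : ℕ} where

  toℕ² : Fin k × Fin ℓ → ℕ × ℕ
  toℕ² = Product.map toℕ toℕ

  toℕ²-adj : ∀ {x y} → Graph.Adj (P k ⊠ P ℓ) x y →
             Graph.Adj (P∞ ⊠ P∞) (toℕ² x) (toℕ² y)
  toℕ²-adj = ⊠-map {G = P k} {P∞} {P ℓ} {P∞} toℕ toℕ id id

  extend : (Fin k × Fin ℓ → Fin k × Fin ℓ → Bool) → ℕ × ℕ → ℕ × ℕ → Bool
  extend R (i , j) (i' , j') with zip (fin? k i) (fin? ℓ j) | zip (fin? k i') (fin? ℓ j')
  ... | just x | just y = R x y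
  ... | _      | _      = false

  extend-toℕ² : ∀ R x y → extend R (toℕ² x) (toℕ² y) ≡ R x y
  extend-toℕ² R (a , b) (a' , b')
    rewrite fin?-toℕ a | fin?-toℕ b | fin?-toℕ a' | fin?-toℕ b' = refl

  Hom-target : (O : Orientation (P k ⊠ P ℓ)) → Hom (Orientation.oriented O) Target.oriented
  Hom-target O = label ∘ toℕ² , λ x y xy →
    label-arc (toℕ²-adj (arc⇒edge x y xy))
              (trans (extend-toℕ² arc x y) xy)
              (trans (extend-toℕ² arc y x) (¬-not (noOpp x y xy)))
    where
    open Orientation O
    open Potentials (extend arc)

corollary3 : (k ℓ : ℕ) → 3 ≤ k → 3 ≤ ℓ →
    UpperOrientedChromatic≤ (P k ⊠ P ℓ) 126
corollary3 k ℓ _ _ =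
  upperOrientedChromatic≤-via (m≤m+n 112 14) Fin112↔Col×Bits Target.oriented Hom-target
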